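{- Let $\mathbb{F}$ be a field and $X=\{x_{ij}:1\le i,j\le n\}$ noncommuting variables. The Moore determinant $\mathrm{Mdet}_n(X)$ can be computed by polynomial-size (in $n$) noncommutative arithmetic circuits over $\mathbb{F}$ if and only if the Moore permanent $\mathrm{Mperm}_n(X)$ can be computed by polynomial-size noncommutative arithmetic circuits over $\mathbb{F}$.
   Context: For $\sigma\in S_n$, write $\sigma$ as a product of disjoint cycles $(c_{11}\cdots c_{1l_1})\cdots(c_{r1}\cdots c_{rl_r})$ (fixed points included) with each cycle starting at its smallest element and $c_{11}>c_{21}>\cdots>c_{r1}$; let $w_\sigma=\prod_{i=1}^r\big(x_{c_{i1},c_{i2}}\cdots x_{c_{il_i},c_{i1}}\big)$ with the factors in the order $i=1,\ldots,r$. Then $\mathrm{Mdet}_n(X)=\sum_{\sigma\in S_n}\mathrm{sgn}(\sigma)w_\sigma$ and $\mathrm{Mperm}_n(X)=\sum_{\sigma\in S_n}w_\sigma$. A noncommutative arithmetic circuit over $\mathbb{F}$ is a directed acyclic graph with leaves labelled by variables or field elements and internal fan-in-two addition and multiplication gates (multiplication with ordered left/right children), computing a polynomial in the free noncommutative polynomial ring at a designated output; size is the number of nodes. -}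

module Defs where

open import Level using (Level; _⊔_) renaming (suc to lsuc)
open import Algebra.Bundles using (CommutativeRing)
open import Data.Nat using (ℕ; zero; suc; _≤_; _^_; _∸_) renaming (_*_ to _*ℕ_)
open import Data.Fin using (Fin; toℕ; fromℕ)
open import Data.Fin.Properties using () renaming (_≟_ to _≟F_)
open import Data.Nat.Properties using () renaming (_≤?_ to _≤ℕ?_)
open import Data.Bool using (Bool; true; false; not; _∧_; if_then_else_)
open import Data.List using (List; []; _∷_; _++_; map; concatMap; foldr; length; allFin; reverse)
open import Data.Vec using (Vec; []; _∷_; lookup)
open import Data.Product using (_×_; _,_; proj₁; proj₂; Σ; ∃)
open import Relation.Nullary using (¬_; does)
open import Relation.Binary.PropositionalEquality using (_≡_)
open import Data.Product.Properties using (≡-dec)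
open import Data.List.Properties using () renaming (≡-dec to ≡-decL)

record Field (c ℓ : Level) : Set (lsuc (c ⊔ ℓ)) where
  field
    commutativeRing : CommutativeRing c ℓ
  open CommutativeRing commutativeRing public
  field
    1≉0     : ¬ (1# ≈ 0#)
    inverse : ∀ x → ¬ (x ≈ 0#) → Σ Carrier λ y → x * y ≈ 1#

-- Noncommutative variables x_{ij}, 1 ≤ i,j ≤ n, are indexed by Fin n × Fin n
-- (0-based).  A monomial of the free noncommutative polynomial ring is a word
-- over the variables.

Var : ℕ → Set
Var n = Fin n × Fin n

Word : ℕ → Set
Word n = List (Var n)

_≟W_ : ∀ {n} (u v : Word n) → Relation.Nullary.Dec (u ≡ v)
_≟W_ = ≡-decL (≡-dec _≟F_ _≟F_)

splits : ∀ {A : Set} → List A → List (List A × List A)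
splits []       = ([] , []) ∷ []
splits (a ∷ as) = ([] , a ∷ as) ∷ map (λ p → (a ∷ proj₁ p , proj₂ p)) (splits as)

allB : ∀ {A : Set} → (A → Bool) → List A → Bool
allB f []       = true
allB f (a ∷ as) = f a ∧ allB f as

module Poly {c ℓ} (F : Field c ℓ) where
  open Field F using (Carrier; _≈_; _+_; _*_; -_; 0#; 1#)

  sumL : List Carrier → Carrier
  sumL = foldr _+_ 0#

  NCPoly : ℕ → Set c
  NCPoly n = Word n → Carrier

  _≋_ : ∀ {n} → NCPoly n → NCPoly n → Set ℓ
  p ≋ q = ∀ w → p w ≈ q w

  varP : ∀ {n} → Var n → NCPoly n
  varP x (y ∷ []) = if does (x ≟V y) then 1# else 0#
    where _≟V_ = ≡-dec _≟F_ _≟F_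
  varP x _        = 0#

  constP : ∀ {n} → Carrier → NCPoly n
  constP a []      = a
  constP a (_ ∷ _) = 0#

  addP : ∀ {n} → NCPoly n → NCPoly n → NCPoly n
  addP p q w = p w + q w

  mulP : ∀ {n} → NCPoly n → NCPoly n → NCPoly n
  mulP p q w = sumL (map (λ uv → p (proj₁ uv) * q (proj₂ uv)) (splits w))

  -- Noncommutative arithmetic circuits, as DAGs given in topological order
  -- (straight-line programs).

  data Gate (n m : ℕ) : Set c where
    leafVar   : Var n → Gate n m
    leafConst : Carrier → Gate n m
    addG      : Fin m → Fin m → Gate n m
    mulG      : (left right : Fin m) → Gate n m

  data Gates (n : ℕ) : ℕ → Set c where
    []  : Gates n zero
    _▷_ : ∀ {m} → Gates n m → Gate n m → Gates n (suc m)

  record Circuit (n : ℕ) : Set c where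
    constructor circuit
    field
      size   : ℕ
      nodes  : Gates n size
      output : Fin size

  evalGates : ∀ {n m} → Gates n m → Fin m → NCPoly n
  evalGates (gs ▷ g) Fin.zero    = evalGate g
    where
    evalGate : _ → NCPoly _
    evalGate (leafVar x)   = varP x
    evalGate (leafConst a) = constP a
    evalGate (addG i j)    = addP (evalGates gs i) (evalGates gs j)
    evalGate (mulG i j)    = mulP (evalGates gs i) (evalGates gs j)
  evalGates (gs ▷ g) (Fin.suc k) = evalGates gs k

  eval : ∀ {n} → Circuit n → NCPoly n
  eval (circuit s gs o) = evalGates gs o

  -- S_n is enumerated as the list of all bijective maps Fin n → Fin n,
  -- represented by their value tables (injective vectors).
  allVecs : (n k : ℕ) → List (Vec (Fin n) k)
  allVecs n zero    = [] ∷ []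
  allVecs n (suc k) = concatMap (λ i → map (i ∷_) (allVecs n k)) (allFin n)

  injective? : ∀ {n} → Vec (Fin n) n → Bool
  injective? {n} v =
    allB (λ i → allB (λ j → does (i ≟F j) ∨' not (does (lookup v i ≟F lookup v j))) (allFin n)) (allFin n)
    where
    _∨'_ : Bool → Bool → Bool
    true ∨' _ = true
    false ∨' b = b

  filterB : ∀ {A : Set} → (A → Bool) → List A → List A
  filterB f []       = []
  filterB f (a ∷ as) = if f a then a ∷ filterB f as else filterB f as

  Sn : (n : ℕ) → List (Vec (Fin n) n)
  Sn n = filterB injective? (allVecs n n)

  orbit : ∀ {n} → (Fin n → Fin n) → Fin n → List (Fin n)
  orbit {n} σ s = s ∷ go n (σ s)
    where
    go : ℕ → Fin n → List (Fin n)
    go zero    _ = []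
    go (suc f) t = if does (t ≟F s) then [] else t ∷ go f (σ t)

  isCycleMin : ∀ {n} → (Fin n → Fin n) → Fin n → Bool
  isCycleMin σ s = allB (λ t → does (toℕ s ≤ℕ? toℕ t)) (orbit σ s)

  cycleWord : ∀ {n} → (Fin n → Fin n) → Fin n → Word _
  cycleWord σ s = map (λ t → (t , σ t)) (orbit σ s)

  cycleMins : ∀ {n} → (Fin n → Fin n) → List (Fin n)
  cycleMins {n} σ = filterB (isCycleMin σ) (reverse (allFin n))

  wordOf : ∀ {n} → Vec (Fin n) n → Word n
  wordOf v = concatMap (cycleWord (lookup v)) (cycleMins (lookup v))

  odd? : ℕ → Bool
  odd? zero    = false
  odd? (suc k) = not (odd? k)

  sgn : ∀ {n} → Vec (Fin n) n → Carrier
  sgn {n} v = if odd? (n ∸ length (cycleMins (lookup v))) then - 1# else 1#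

  Mdet : (n : ℕ) → NCPoly n
  Mdet n w = sumL (map (λ σ → if does (wordOf σ ≟W w) then sgn σ else 0#) (Sn n))

  Mperm : (n : ℕ) → NCPoly n
  Mperm n w = sumL (map (λ σ → if does (wordOf σ ≟W w) then 1# else 0#) (Sn n))

  PolySizeComputable : ((n : ℕ) → NCPoly n) → Set (c ⊔ ℓ)
  PolySizeComputable P =
    Σ ℕ λ a → Σ ℕ λ k → ∀ n → Σ (Circuit n) λ C →
      (Circuit.size C ≤ a *ℕ (suc n ^ k)) × (eval C ≋ P n)

-- For σ ∈ S_n the Moore word w_σ reads the cycles of σ one after the other, by decreasing
-- least element, and each cycle begins with the letter whose row is its least element.  So
-- a deterministic automaton whose state is the least row read so far meets exactly one new
-- minimum per cycle; weighting new minima by -1 and the start by (-1)^n it gives w_σ the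
-- weight (-1)^(n - #cycles) = sgn σ.  As sgn² = 1, each of Mdet and Mperm is the Hadamard
-- product of the other with this series.
-- The Hadamard product with the series of a deterministic weighted automaton with S states
-- costs a factor O(S³) in circuit size: each gate f is replaced by the S² polynomials
-- restrict p q f, the part of f read along runs from p to q.  These add entrywise and
-- multiply like matrices: restrict p q (f g) = Σ_r restrict p r f · restrict r q g.

module Submission where

open import Level using (Level; _⊔_)
open import Function.Base using (_∘_; flip)
open import Function.Bundles using (_⇔_; mk⇔; Equivalence)
open import Data.Nat as ℕ using (ℕ; zero; suc; _≤_; _^_; _∸_; z≤n; s≤s)
import Data.Nat.Properties as ℕ
open import Data.Nat.Tactic.RingSolver using (solve-∀)
open import Data.Fin using (Fin; toℕ; fromℕ; inject₁)
open import Data.Fin.Properties using (_≟_; toℕ-inject₁; toℕ-fromℕ; toℕ<n)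
open import Data.Bool using (Bool; true; false; if_then_else_)
open import Data.Bool.Properties using (T-≡)
open import Data.Product using (_×_; _,_; proj₁; proj₂; Σ; uncurry)
open import Data.Product.Properties using (≡-dec)
open import Data.Sum using (inj₁; inj₂; [_,_])
open import Data.Unit using (⊤; tt)
open import Data.Vec using (Vec; lookup)
open import Data.List using (List; []; _∷_; _++_; map; concatMap; length; allFin; reverse; drop)
open import Data.List.Properties using (map-∘; unfold-reverse; length-reverse; length-tabulate)
open import Data.List.Relation.Unary.All as All using (All; []; _∷_)
import Data.List.Relation.Unary.All.Properties as All
import Data.List.Relation.Unary.Any.Properties as Any
open import Data.List.Relation.Unary.AllPairs as AllPairs using (AllPairs; []; _∷_)
import Data.List.Relation.Unary.AllPairs.Properties as AllPairs
open import Relation.Nullary using (does; yes; no)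
open import Relation.Nullary.Decidable using (dec-true; dec-false)
open import Relation.Binary.PropositionalEquality as ≡ using (_≡_; refl; cong)
import Relation.Binary.Reasoning.Setoid as SetoidReasoning
import Algebra.Properties.Ring as RingProperties
import Algebra.Properties.Semiring.Sum as SemiringSum
import Algebra.Properties.CommutativeSemigroup as CommutativeSemigroupProperties

open import Defs

All-reverse⁺ : ∀ {A : Set} {P : A → Set} {xs} → All P xs → All P (reverse xs)
All-reverse⁺ ps = All.tabulate (All.lookup ps ∘ Any.reverse⁻)

AllPairs-reverse⁺ : ∀ {A : Set} {R : A → A → Set} {xs} → AllPairs R xs → AllPairs (flip R) (reverse xs)
AllPairs-reverse⁺ {xs = []}     []         = []
AllPairs-reverse⁺ {xs = x ∷ xs} (px ∷ pxs) rewrite unfold-reverse x xs =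
  AllPairs.++⁺ (AllPairs-reverse⁺ pxs) ([] ∷ []) (All.map (_∷ []) (All-reverse⁺ px))

reverse-allFin-descending : ∀ n → AllPairs ℕ._>_ (n ∷ map toℕ (reverse (allFin n)))
reverse-allFin-descending n =
  All.map⁺ (All-reverse⁺ (All.universal toℕ<n (allFin n))) ∷
  AllPairs.map⁺ (AllPairs-reverse⁺ (AllPairs.tabulate⁺-< (λ i<j → i<j)))

allB⇒All : ∀ {A : Set} {f : A → Bool} xs → allB f xs ≡ true → All (λ x → f x ≡ true) xs
allB⇒All []       _ = []
allB⇒All {f = f} (x ∷ xs) allTrue with f x in fx≡true
... | true = fx≡true ∷ allB⇒All xs allTrue

-- A product entry takes S multiplications and S + 1 gates to add them up.
entryCost : ℕ → ℕ
entryCost S = 2 ℕ.* S ℕ.+ 3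

3≤entryCost : ∀ S → 3 ≤ entryCost S
3≤entryCost S = ℕ.m≤n+m 3 (2 ℕ.* S)

1≤entryCost : ∀ S → 1 ≤ entryCost S
1≤entryCost S = ℕ.≤-trans (s≤s z≤n) (3≤entryCost S)

sumEntry≤entryCost : ∀ S → S ℕ.* 1 ℕ.+ suc S ≤ entryCost S
sumEntry≤entryCost S = ℕ.≤-trans (ℕ.≤-reflexive (eq S)) (ℕ.+-monoʳ-≤ (2 ℕ.* S) (s≤s z≤n))
  where
  eq : ∀ S → S ℕ.* 1 ℕ.+ suc S ≡ 2 ℕ.* S ℕ.+ 1
  eq = solve-∀

hadamardSize≤ : ∀ n a k m → m ≤ a ℕ.* suc n ^ k →
  m ℕ.* (suc n ℕ.* (suc n ℕ.* entryCost (suc n))) ℕ.+ (suc (suc n) ℕ.+ 2) ≤ (5 ℕ.* a ℕ.+ 4) ℕ.* suc n ^ (3 ℕ.+ k)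
hadamardSize≤ n a k m m≤ = begin
  m ℕ.* (s ℕ.* (s ℕ.* entryCost s)) ℕ.+ (suc s ℕ.+ 2)
    ≤⟨ ℕ.+-mono-≤ (ℕ.*-mono-≤ m≤ (ℕ.*-monoʳ-≤ s (ℕ.*-monoʳ-≤ s entryCost≤5s))) (ℕ.≤-trans s+3≤4s (ℕ.*-monoʳ-≤ 4 s≤t)) ⟩
  a ℕ.* s ^ k ℕ.* (s ℕ.* (s ℕ.* (5 ℕ.* s))) ℕ.+ 4 ℕ.* t
    ≡⟨ collect a s (s ^ k) ⟩
  (5 ℕ.* a ℕ.+ 4) ℕ.* t ∎
  where
  open ℕ.≤-Reasoning
  s = suc n
  t = s ^ (3 ℕ.+ k)
  s≤t : s ≤ t
  s≤t = ℕ.m≤m*n s (s ^ (2 ℕ.+ k)) {{ℕ.m^n≢0 s (2 ℕ.+ k)}}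
  s+3≤4s : suc s ℕ.+ 2 ≤ 4 ℕ.* s
  s+3≤4s = ℕ.≤-trans (ℕ.m≤m+n (suc s ℕ.+ 2) (3 ℕ.* n)) (ℕ.≤-reflexive (eq n))
    where
    eq : ∀ n → 1 ℕ.+ (1 ℕ.+ n) ℕ.+ 2 ℕ.+ 3 ℕ.* n ≡ 4 ℕ.* (1 ℕ.+ n)
    eq = solve-∀
  entryCost≤5s : entryCost s ≤ 5 ℕ.* s
  entryCost≤5s = ℕ.≤-trans (ℕ.m≤m+n (entryCost s) (3 ℕ.* n)) (ℕ.≤-reflexive (eq n))
    where
    eq : ∀ n → 2 ℕ.* (1 ℕ.+ n) ℕ.+ 3 ℕ.+ 3 ℕ.* n ≡ 5 ℕ.* (1 ℕ.+ n)
    eq = solve-∀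
  collect : ∀ a s u → a ℕ.* u ℕ.* (s ℕ.* (s ℕ.* (5 ℕ.* s))) ℕ.+ 4 ℕ.* (s ℕ.* (s ℕ.* (s ℕ.* u)))
                    ≡ (5 ℕ.* a ℕ.+ 4) ℕ.* (s ℕ.* (s ℕ.* (s ℕ.* u)))
  collect = solve-∀

module _ {c ℓ : Level} (F : Field c ℓ) where
  open Field F renaming (refl to ≈-refl)
  open Poly F
  open RingProperties ring using (-1*x≈-x; -‿involutive)
  open SemiringSum semiring using (sum-syntax; sum-cong-≋; ∑-distrib-+; sum-replicate-zero)
  open CommutativeSemigroupProperties *-commutativeSemigroup using (interchange)
  open SetoidReasoning setoid

  sign : ℕ → Carrier
  sign k = if odd? k then - 1# else 1#

  -1*-1≈1 : - 1# * - 1# ≈ 1#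
  -1*-1≈1 = trans (-1*x≈-x (- 1#)) (-‿involutive 1#)

  sign-suc : ∀ k → sign (suc k) ≈ - 1# * sign k
  sign-suc k with odd? k
  ... | true  = sym -1*-1≈1
  ... | false = sym (*-identityʳ (- 1#))

  sign-+ : ∀ a b → sign (a ℕ.+ b) ≈ sign a * sign b
  sign-+ zero    b = sym (*-identityˡ (sign b))
  sign-+ (suc a) b = begin
    sign (suc (a ℕ.+ b))    ≈⟨ sign-suc (a ℕ.+ b) ⟩
    - 1# * sign (a ℕ.+ b)   ≈⟨ *-congˡ (sign-+ a b) ⟩
    - 1# * (sign a * sign b) ≈⟨ sym (*-assoc _ _ _) ⟩
    - 1# * sign a * sign b   ≈⟨ *-congʳ (sym (sign-suc a)) ⟩
    sign (suc a) * sign b    ∎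

  sign*sign≈1 : ∀ k → sign k * sign k ≈ 1#
  sign*sign≈1 k with odd? k
  ... | true  = -1*-1≈1
  ... | false = *-identityˡ 1#

  sumL-≈0 : ∀ {A : Set} (xs : List A) {f : A → Carrier} → (∀ x → f x ≈ 0#) → sumL (map f xs) ≈ 0#
  sumL-≈0 []       f≈0 = ≈-refl
  sumL-≈0 (x ∷ xs) f≈0 = trans (+-cong (f≈0 x) (sumL-≈0 xs f≈0)) (+-identityˡ 0#)

  *-distribˡ-sumL : ∀ {A : Set} a (f : A → Carrier) xs → a * sumL (map f xs) ≈ sumL (map (λ x → a * f x) xs)
  *-distribˡ-sumL a f []       = zeroʳ a
  *-distribˡ-sumL a f (x ∷ xs) = trans (distribˡ a _ _) (+-congˡ (*-distribˡ-sumL a f xs))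

  sumL-∑-comm : ∀ {A : Set} {S} (f : A → Fin S → Carrier) xs →
    sumL (map (λ x → ∑[ r < S ] f x r) xs) ≈ ∑[ r < S ] sumL (map (λ x → f x r) xs)
  sumL-∑-comm {S = S} f []       = sym (sum-replicate-zero S)
  sumL-∑-comm         f (x ∷ xs) =
    trans (+-congˡ (sumL-∑-comm f xs)) (sym (∑-distrib-+ (f x) _))

  ∑-indicator : ∀ {S} (x : Fin S) (h : Fin S → Carrier) → ∑[ r < S ] (if does (x ≟ r) then h r else 0#) ≈ h x
  ∑-indicator {suc S} Fin.zero    h = trans (+-congˡ (sum-replicate-zero S)) (+-identityʳ (h Fin.zero))
  ∑-indicator {suc S} (Fin.suc x) h = trans (+-identityˡ _) (∑-indicator x (h ∘ Fin.suc))

  splits-sumL-cong : ∀ {A : Set} (w : List A) {f g : List A × List A → Carrier} →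
    (∀ u v → u ++ v ≡ w → f (u , v) ≈ g (u , v)) → sumL (map f (splits w)) ≈ sumL (map g (splits w))
  splits-sumL-cong []       f≈g = +-cong (f≈g [] [] refl) ≈-refl
  splits-sumL-cong (a ∷ as) {f} {g} f≈g = +-cong (f≈g [] (a ∷ as) refl) (begin
    sumL (map f (map cons (splits as)))   ≡⟨ cong sumL (≡.sym (map-∘ (splits as))) ⟩
    sumL (map (f ∘ cons) (splits as))     ≈⟨ splits-sumL-cong as (λ u v e → f≈g (a ∷ u) v (cong (a ∷_) e)) ⟩
    sumL (map (g ∘ cons) (splits as))     ≡⟨ cong sumL (map-∘ (splits as)) ⟩
    sumL (map g (map cons (splits as)))   ∎)
    where
    cons : _ × _ → _ × _
    cons (u , v) = a ∷ u , v

  if-sumL : ∀ {A : Set} b a (f : A → Carrier) xs →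
    (if b then a * sumL (map f xs) else 0#) ≈ sumL (map (λ x → if b then a * f x else 0#) xs)
  if-sumL true  a f xs = *-distribˡ-sumL a f xs
  if-sumL false a f xs = sym (sumL-≈0 xs (λ _ → ≈-refl))

  if-*ʳ : ∀ b x y → (if b then x else 0#) * y ≈ (if b then x * y else 0#)
  if-*ʳ true  x y = ≈-refl
  if-*ʳ false x y = zeroˡ y

  constP-0# : ∀ {n} → constP {n} 0# ≋ λ _ → 0#
  constP-0# []      = ≈-refl
  constP-0# (_ ∷ _) = ≈-refl

  mulP-constPˡ : ∀ {n} a (P : NCPoly n) → mulP (constP a) P ≋ λ w → a * P w
  mulP-constPˡ a P []      = +-identityʳ _
  mulP-constPˡ a P (x ∷ w) = begin
    a * P (x ∷ w) + sumL (map f (map cons (splits w)))  ≡⟨ cong (λ s → a * P (x ∷ w) + sumL s) (≡.sym (map-∘ (splits w))) ⟩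
    a * P (x ∷ w) + sumL (map (f ∘ cons) (splits w))    ≈⟨ +-congˡ (sumL-≈0 (splits w) (λ uv → zeroˡ (P (proj₂ uv)))) ⟩
    a * P (x ∷ w) + 0#                                  ≈⟨ +-identityʳ _ ⟩
    a * P (x ∷ w)                                       ∎
    where
    f : _ × _ → Carrier
    f (u , v) = constP a u * P v
    cons : _ × _ → _ × _
    cons (u , v) = x ∷ u , v

  addP-cong : ∀ {n} {P P′ Q Q′ : NCPoly n} → P ≋ P′ → Q ≋ Q′ → addP P Q ≋ addP P′ Q′
  addP-cong P≋P′ Q≋Q′ w = +-cong (P≋P′ w) (Q≋Q′ w)

  mulP-cong : ∀ {n} {P P′ Q Q′ : NCPoly n} → P ≋ P′ → Q ≋ Q′ → mulP P Q ≋ mulP P′ Q′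
  mulP-cong P≋P′ Q≋Q′ w = splits-sumL-cong w (λ u v _ → *-cong (P≋P′ u) (Q≋Q′ v))

  -- Weighted automata

  record WeightedAutomaton (n S : ℕ) : Set c where
    field
      initial : Fin S
      factor : Carrier
      next   : Fin S → Var n → Fin S
      weight : Fin S → Var n → Carrier

  module Automaton {n S : ℕ} (A : WeightedAutomaton n S) where
    open WeightedAutomaton A public

    run : Fin S → Word n → Fin S
    run p []      = p
    run p (x ∷ w) = run (next p x) w

    pathWeight : Fin S → Word n → Carrier
    pathWeight p []      = 1#
    pathWeight p (x ∷ w) = weight p x * pathWeight (next p x) w

    series : Word n → Carrier
    series w = factor * pathWeight initial w

    run-++ : ∀ p u v → run p (u ++ v) ≡ run (run p u) v
    run-++ p []      v = refl
    run-++ p (x ∷ u) v = run-++ (next p x) u v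

    pathWeight-++ : ∀ p u v → pathWeight p (u ++ v) ≈ pathWeight p u * pathWeight (run p u) v
    pathWeight-++ p []      v = sym (*-identityˡ _)
    pathWeight-++ p (x ∷ u) v = trans (*-congˡ (pathWeight-++ (next p x) u v)) (sym (*-assoc _ _ _))

    restrict : Fin S → Fin S → NCPoly n → NCPoly n
    restrict p q P w = if does (run p w ≟ q) then pathWeight p w * P w else 0#

    ∑-restrict : ∀ p P w → ∑[ q < S ] restrict p q P w ≈ pathWeight p w * P w
    ∑-restrict p P w = ∑-indicator (run p w) (λ _ → pathWeight p w * P w)

    restrict-constP : ∀ p q a → restrict p q (constP a) ≋ constP (if does (p ≟ q) then a else 0#)
    restrict-constP p q a [] with does (p ≟ q)
    ... | true  = *-identityˡ a
    ... | false = ≈-refl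
    restrict-constP p q a (x ∷ w) with does (run p (x ∷ w) ≟ q)
    ... | true  = zeroʳ _
    ... | false = ≈-refl

    restrict-varP : ∀ p q x → restrict p q (varP x) ≋ λ w → (if does (next p x ≟ q) then weight p x else 0#) * varP x w
    restrict-varP p q x [] with does (p ≟ q)
    ... | true  = trans (zeroʳ _) (sym (zeroʳ _))
    ... | false = sym (zeroʳ _)
    restrict-varP p q x (y ∷ z ∷ w) with does (run p (y ∷ z ∷ w) ≟ q)
    ... | true  = trans (zeroʳ _) (sym (zeroʳ _))
    ... | false = sym (zeroʳ _)
    restrict-varP p q x (y ∷ []) with ≡-dec _≟_ _≟_ x y
    ... | no _ with does (next p y ≟ q)
    ...   | true  = trans (zeroʳ _) (sym (zeroʳ _))
    ...   | false = sym (zeroʳ _)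
    restrict-varP p q x (x ∷ []) | yes refl with does (next p x ≟ q)
    ...   | true  = trans (*-identityʳ _) (trans (*-identityʳ _) (sym (*-identityʳ _)))
    ...   | false = sym (zeroˡ 1#)

    restrict-addP : ∀ p q P Q → restrict p q (addP P Q) ≋ addP (restrict p q P) (restrict p q Q)
    restrict-addP p q P Q w with does (run p w ≟ q)
    ... | true  = distribˡ _ _ _
    ... | false = sym (+-identityˡ 0#)

    restrict-split : ∀ p q P Q u v →
      ∑[ r < S ] (restrict p r P u * restrict r q Q v) ≈ restrict p q (λ _ → P u * Q v) (u ++ v)
    restrict-split p q P Q u v = begin
      ∑[ r < S ] (restrict p r P u * restrict r q Q v)
        ≈⟨ sum-cong-≋ (λ r → if-*ʳ (does (run p u ≟ r)) _ _) ⟩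
      ∑[ r < S ] (if does (run p u ≟ r) then pathWeight p u * P u * restrict r q Q v else 0#)
        ≈⟨ ∑-indicator (run p u) (λ r → pathWeight p u * P u * restrict r q Q v) ⟩
      pathWeight p u * P u * restrict (run p u) q Q v
        ≈⟨ collapse ⟩
      restrict p q (λ _ → P u * Q v) (u ++ v) ∎
      where
      collapse : pathWeight p u * P u * restrict (run p u) q Q v ≈ restrict p q (λ _ → P u * Q v) (u ++ v)
      collapse rewrite run-++ p u v with does (run (run p u) v ≟ q)
      ... | true  = trans (interchange _ _ _ _) (*-congʳ (sym (pathWeight-++ p u v)))
      ... | false = zeroʳ _

    restrict-mulP : ∀ p q P Q → restrict p q (mulP P Q) ≋ λ w → ∑[ r < S ] mulP (restrict p r P) (restrict r q Q) w
    restrict-mulP p q P Q w = begin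
      restrict p q (mulP P Q) w
        ≈⟨ if-sumL (does (run p w ≟ q)) (pathWeight p w) _ (splits w) ⟩
      sumL (map (λ (u , v) → restrict p q (λ _ → P u * Q v) w) (splits w))
        ≈⟨ splits-sumL-cong w (λ { u v refl → sym (restrict-split p q P Q u v) }) ⟩
      sumL (map (λ (u , v) → ∑[ r < S ] (restrict p r P u * restrict r q Q v)) (splits w))
        ≈⟨ sumL-∑-comm (λ (u , v) r → restrict p r P u * restrict r q Q v) (splits w) ⟩
      ∑[ r < S ] mulP (restrict p r P) (restrict r q Q) w ∎

  -- Circuits built gate by gate

  module _ {n : ℕ} where
    record _≼_ {m m′} (gs : Gates n m) (gs′ : Gates n m′) : Set ℓ where
      field
        embed      : Fin m → Fin m′
        embed-eval : ∀ i → evalGates gs′ (embed i) ≋ evalGates gs i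
    open _≼_

    ≼-refl : ∀ {m} {gs : Gates n m} → gs ≼ gs
    ≼-refl = record { embed = λ i → i ; embed-eval = λ _ _ → ≈-refl }

    ≼-trans : ∀ {m m′ m″} {gs : Gates n m} {gs′ : Gates n m′} {gs″ : Gates n m″} → gs ≼ gs′ → gs′ ≼ gs″ → gs ≼ gs″
    ≼-trans e e′ = record
      { embed      = embed e′ ∘ embed e
      ; embed-eval = λ i w → trans (embed-eval e′ (embed e i) w) (embed-eval e i w)
      }

    ≼-▷ : ∀ {m} {gs : Gates n m} g → gs ≼ (gs ▷ g)
    ≼-▷ g = record { embed = Fin.suc ; embed-eval = λ _ _ → ≈-refl }

    record Computes {I : Set} {m} (gs : Gates n m) (F : I → NCPoly n) : Set ℓ where
      field
        gate      : I → Fin m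
        gate-eval : ∀ i → evalGates gs (gate i) ≋ F i
    open Computes

    computes-≼ : ∀ {I : Set} {F : I → NCPoly n} {m m′} {gs : Gates n m} {gs′ : Gates n m′} →
      gs ≼ gs′ → Computes gs F → Computes gs′ F
    computes-≼ e hs = record
      { gate      = embed e ∘ gate hs
      ; gate-eval = λ i w → trans (embed-eval e (gate hs i) w) (gate-eval hs i w)
      }

    computes-⊎ : ∀ {I J : Set} {F : I → NCPoly n} {G : J → NCPoly n} {m} {gs : Gates n m} →
      Computes gs F → Computes gs G → Computes gs [ F , G ]
    computes-⊎ fs gs = record
      { gate      = [ gate fs , gate gs ]
      ; gate-eval = λ { (inj₁ i) → gate-eval fs i ; (inj₂ j) → gate-eval gs j }
      }

    record Extension {I : Set} {m} (gs : Gates n m) (E : ℕ) (F : I → NCPoly n) : Set (c ⊔ ℓ) where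
      field
        size     : ℕ
        gates    : Gates n size
        extends  : gs ≼ gates
        bounded  : size ≤ m ℕ.+ E
        computes : Computes gates F
    open Extension

    Construction : {I J : Set} → (I → NCPoly n) → ℕ → (J → NCPoly n) → Set (c ⊔ ℓ)
    Construction H E F = ∀ {m} {gs : Gates n m} → Computes gs H → Extension gs E F

    module _ {I : Set} {H : I → NCPoly n} where
      emit : ∀ {f} (g : ∀ {m} → (I → Fin m) → Gate n m) →
        (∀ {m} {gs : Gates n m} (hs : Computes gs H) → evalGates (gs ▷ g (gate hs)) Fin.zero ≋ f) →
        Construction H 1 (λ (_ : ⊤) → f)
      emit g g-eval {m} hs = record
        { gates    = _ ▷ g (gate hs)
        ; extends  = ≼-▷ _
        ; bounded  = ℕ.≤-reflexive (ℕ.+-comm 1 m)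
        ; computes = record { gate = λ _ → Fin.zero ; gate-eval = λ _ → g-eval hs }
        }

      constC : ∀ a → Construction H 1 (λ _ → constP a)
      constC a = emit (λ _ → leafConst a) (λ _ _ → ≈-refl)

      varC : ∀ x → Construction H 1 (λ _ → varP x)
      varC x = emit (λ _ → leafVar x) (λ _ _ → ≈-refl)

      addC : ∀ i j → Construction H 1 (λ _ → addP (H i) (H j))
      addC i j = emit (λ t → addG (t i) (t j)) (λ hs → addP-cong (gate-eval hs i) (gate-eval hs j))

      mulC : ∀ i j → Construction H 1 (λ _ → mulP (H i) (H j))
      mulC i j = emit (λ t → mulG (t i) (t j)) (λ hs → mulP-cong (gate-eval hs i) (gate-eval hs j))

      relax : ∀ {J : Set} {F : J → NCPoly n} {E E′} → E ≤ E′ → Construction H E F → Construction H E′ F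
      relax E≤E′ build hs = record
        { gates    = gates (build hs)
        ; extends  = extends (build hs)
        ; bounded  = ℕ.≤-trans (bounded (build hs)) (ℕ.+-monoʳ-≤ _ E≤E′)
        ; computes = computes (build hs)
        }

      construction-≋ : ∀ {J : Set} {F G : J → NCPoly n} {E} → (∀ j → F j ≋ G j) → Construction H E F → Construction H E G
      construction-≋ F≋G build hs = record
        { gates    = gates (build hs)
        ; extends  = extends (build hs)
        ; bounded  = bounded (build hs)
        ; computes = record
          { gate      = gate (computes (build hs))
          ; gate-eval = λ j w → trans (gate-eval (computes (build hs)) j w) (F≋G j w)
          }
        }

      mapOutputs : ∀ {J K : Set} {F : J → NCPoly n} {E} (f : K → J) →
        Construction H E F → Construction H E (F ∘ f)
      mapOutputs f build hs = record
        { gates    = gates (build hs)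
        ; extends  = extends (build hs)
        ; bounded  = bounded (build hs)
        ; computes = record { gate = gate (computes (build hs)) ∘ f ; gate-eval = gate-eval (computes (build hs)) ∘ f }
        }

      infixr 4 _then_
      _then_ : ∀ {J K : Set} {F : J → NCPoly n} {G : K → NCPoly n} {E E′} →
        Construction H E F → Construction [ H , F ] E′ G → Construction H (E ℕ.+ E′) G
      _then_ {E = E} {E′} first second {m} hs = record
        { gates    = gates g₂
        ; extends  = ≼-trans (extends g₁) (extends g₂)
        ; bounded  = ℕ.≤-trans (bounded g₂)
                       (ℕ.≤-trans (ℕ.+-monoˡ-≤ E′ (bounded g₁)) (ℕ.≤-reflexive (ℕ.+-assoc m E E′)))
        ; computes = computes g₂
        }
        where
        g₁ = first hs
        g₂ = second (computes-⊎ (computes-≼ (extends g₁) hs) (computes g₁))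

      forEach : ∀ {J : Set} {E} k {F : Fin k → J → NCPoly n} →
        (∀ x → Construction H E (F x)) → Construction H (k ℕ.* E) (uncurry F)
      forEach zero build {m} hs = record
        { gates    = _
        ; extends  = ≼-refl
        ; bounded  = ℕ.m≤m+n m 0
        ; computes = record { gate = λ { (() , _) } ; gate-eval = λ { (() , _) } }
        }
      forEach {E = E} (suc k) build {m} hs = record
        { gates    = gates rest
        ; extends  = ≼-trans (extends first) (extends rest)
        ; bounded  = ℕ.≤-trans (bounded rest)
                       (ℕ.≤-trans (ℕ.+-monoˡ-≤ (k ℕ.* E) (bounded first)) (ℕ.≤-reflexive (ℕ.+-assoc m E (k ℕ.* E))))
        ; computes = record
          { gate      = λ { (Fin.zero , j) → gate firstThere j ; (Fin.suc x , j) → gate (computes rest) (x , j) }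
          ; gate-eval = λ { (Fin.zero , j) → gate-eval firstThere j ; (Fin.suc x , j) → gate-eval (computes rest) (x , j) }
          }
        }
        where
        first = build Fin.zero hs
        rest = forEach k (build ∘ Fin.suc) (computes-≼ (extends first) hs)
        firstThere = computes-≼ (extends rest) (computes first)

    sumC : ∀ {I} {H : I → NCPoly n} k (ix : Fin k → I) → Construction H (suc k) (λ (_ : ⊤) w → ∑[ r < k ] H (ix r) w)
    sumC zero    ix = construction-≋ (λ _ → constP-0#) (constC 0#)
    sumC (suc k) ix = relax (ℕ.≤-reflexive (ℕ.+-comm (suc k) 1))
      (sumC k (ix ∘ Fin.suc) then addC (inj₁ (ix Fin.zero)) (inj₂ tt))

  -- Hadamard products of circuits with automata

  module Hadamard {n S : ℕ} (A : WeightedAutomaton n S) where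
    open Automaton A
    open Computes
    open Extension

    Blocks : ∀ {m} → Gates n m → Fin m × (Fin S × Fin S) → NCPoly n
    Blocks gs (k , p , q) = restrict p q (evalGates gs k)

    entryC : ∀ {m} (gs : Gates n m) g p q →
      Construction (Blocks gs) (entryCost S) (λ (_ : ⊤) → restrict p q (evalGates (gs ▷ g) Fin.zero))
    entryC gs (leafConst a) p q = relax (1≤entryCost S)
      (construction-≋ (λ _ w → sym (restrict-constP p q a w)) (constC _))
    entryC gs (leafVar x) p q = relax (3≤entryCost S)
      (construction-≋ (λ _ w → trans (mulP-constPˡ _ (varP x) w) (sym (restrict-varP p q x w)))
        (varC x then constC (if does (next p x ≟ q) then weight p x else 0#) then mulC (inj₂ tt) (inj₁ (inj₂ tt))))
    entryC gs (addG i j) p q = relax (1≤entryCost S)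
      (construction-≋ (λ _ w → sym (restrict-addP p q (evalGates gs i) (evalGates gs j) w)) (addC (i , p , q) (j , p , q)))
    entryC gs (mulG i j) p q = relax (sumEntry≤entryCost S)
      (construction-≋ (λ _ w → sym (restrict-mulP p q (evalGates gs i) (evalGates gs j) w))
        (forEach S (λ r → mulC (i , p , r) (j , r , q)) then sumC S (λ r → inj₂ (r , tt))))

    blockCost : ℕ
    blockCost = S ℕ.* (S ℕ.* entryCost S)

    blockC : ∀ {m} (gs : Gates n m) g →
      Construction (Blocks gs) blockCost (λ ((p , q) : Fin S × Fin S) → restrict p q (evalGates (gs ▷ g) Fin.zero))
    blockC gs g = mapOutputs (λ (p , q) → p , q , tt) (forEach S λ p → forEach S λ q → entryC gs g p q)

    blocksC : ∀ {m} (gs : Gates n m) → Extension [] (m ℕ.* blockCost) (Blocks gs)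
    blocksC [] = record
      { gates    = []
      ; extends  = ≼-refl
      ; bounded  = z≤n
      ; computes = record { gate = λ { (() , _) } ; gate-eval = λ { (() , _) } }
      }
    blocksC {suc m} (gs ▷ g) = record
      { gates    = gates new
      ; extends  = ≼-trans (extends old) (extends new)
      ; bounded  = ℕ.≤-trans (bounded new)
                     (ℕ.≤-trans (ℕ.+-monoˡ-≤ blockCost (bounded old)) (ℕ.≤-reflexive (ℕ.+-comm (m ℕ.* blockCost) blockCost)))
      ; computes = record
        { gate      = λ { (Fin.zero , pq) → gate (computes new) pq ; (Fin.suc k , pq) → gate oldThere (k , pq) }
        ; gate-eval = λ { (Fin.zero , pq) → gate-eval (computes new) pq ; (Fin.suc k , pq) → gate-eval oldThere (k , pq) }
        }
      }
      where
      old = blocksC gs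
      new = blockC gs g (computes old)
      oldThere = computes-≼ (extends new) (computes old)

    hadamard : (C : Circuit n) → Σ (Circuit n) λ C′ →
      Circuit.size C′ ≤ Circuit.size C ℕ.* blockCost ℕ.+ (suc S ℕ.+ 2) × eval C′ ≋ λ w → series w * eval C w
    hadamard (circuit m gs o) =
      circuit _ (gates out) (gate (computes out) tt) ,
      ℕ.≤-trans (bounded out) (ℕ.+-monoˡ-≤ (suc S ℕ.+ 2) (bounded (blocksC gs))) ,
      λ w → trans (gate-eval (computes out) tt w) (begin
        mulP (constP factor) (λ w → ∑[ q < S ] restrict initial q (evalGates gs o) w) w
          ≈⟨ mulP-constPˡ factor _ w ⟩
        factor * ∑[ q < S ] restrict initial q (evalGates gs o) w
          ≈⟨ *-congˡ (∑-restrict initial (evalGates gs o) w) ⟩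
        factor * (pathWeight initial w * evalGates gs o w)
          ≈⟨ sym (*-assoc _ _ _) ⟩
        series w * evalGates gs o w ∎)
      where
      out = (sumC S (λ q → o , initial , q) then constC factor then mulC (inj₂ tt) (inj₁ (inj₂ tt)))
              (computes (blocksC gs))

  polySize-≋ : ∀ {P Q : (n : ℕ) → NCPoly n} → (∀ n → P n ≋ Q n) → PolySizeComputable P → PolySizeComputable Q
  polySize-≋ P≋Q (a , k , circuits) = a , k , λ n →
    let (C , C≤ , C≋) = circuits n in C , C≤ , λ w → trans (C≋ w) (P≋Q n w)

  hadamard-polySize : (A : ∀ n → WeightedAutomaton n (suc n)) {P : (n : ℕ) → NCPoly n} →
    PolySizeComputable P → PolySizeComputable (λ n w → Automaton.series (A n) w * P n w)
  hadamard-polySize A (a , k , circuits) = 5 ℕ.* a ℕ.+ 4 , 3 ℕ.+ k , λ n →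
    let (C , C≤ , C≋) = circuits n
        (C′ , C′≤ , C′≋) = Hadamard.hadamard (A n) C
    in C′ , ℕ.≤-trans C′≤ (hadamardSize≤ n a k _ C≤) , λ w → trans (C′≋ w) (*-congˡ (C≋ w))

  -- The Moore sign automaton

  length-filterB : ∀ {A : Set} (f : A → Bool) xs → length (filterB f xs) ≤ length xs
  length-filterB f []       = z≤n
  length-filterB f (x ∷ xs) with f x
  ... | true  = s≤s (length-filterB f xs)
  ... | false = ℕ.m≤n⇒m≤1+n (length-filterB f xs)

  scale-coefficient : ∀ {A : Set} {n} (key : A → Word n) w a (f g : A → Carrier) →
    (∀ x → key x ≡ w → a * f x ≈ g x) → ∀ xs →
    a * sumL (map (λ x → if does (key x ≟W w) then f x else 0#) xs) ≈
      sumL (map (λ x → if does (key x ≟W w) then g x else 0#) xs)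
  scale-coefficient key w a f g af≈g []       = zeroʳ a
  scale-coefficient key w a f g af≈g (x ∷ xs) =
    trans (distribˡ a _ _) (+-cong coefficient (scale-coefficient key w a f g af≈g xs))
    where
    coefficient : a * (if does (key x ≟W w) then f x else 0#) ≈ (if does (key x ≟W w) then g x else 0#)
    coefficient with key x ≟W w
    ... | yes key≡w = af≈g x key≡w
    ... | no  _     = zeroʳ a

  -- State s is the least row read so far; fromℕ n, above every row, means none yet.
  isNewMinimum : ∀ {n} → Fin (suc n) → Var n → Bool
  isNewMinimum s (i , _) = does (toℕ i ℕ.<? toℕ s)

  mooreAutomaton : ∀ n → WeightedAutomaton n (suc n)
  mooreAutomaton n = record
    { initial = fromℕ n
    ; factor  = sign n
    ; next    = λ s x → if isNewMinimum s x then inject₁ (proj₁ x) else s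
    ; weight  = λ s x → if isNewMinimum s x then - 1# else 1#
    }

  module _ {n : ℕ} where
    open Automaton (mooreAutomaton n)

    run-above : ∀ b u → All (λ x → toℕ b ≤ toℕ (proj₁ x)) u → run b u ≡ b
    run-above b []      []           = refl
    run-above b (x ∷ u) (b≤x ∷ b≤u) rewrite dec-false (toℕ (proj₁ x) ℕ.<? toℕ b) (ℕ.≤⇒≯ b≤x) = run-above b u b≤u

    pathWeight-above : ∀ b u → All (λ x → toℕ b ≤ toℕ (proj₁ x)) u → pathWeight b u ≈ 1#
    pathWeight-above b []      []           = ≈-refl
    pathWeight-above b (x ∷ u) (b≤x ∷ b≤u) rewrite dec-false (toℕ (proj₁ x) ℕ.<? toℕ b) (ℕ.≤⇒≯ b≤x) =
      trans (*-identityˡ _) (pathWeight-above b u b≤u)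

    module _ (σ : Fin n → Fin n) (s : Fin n) (b : Fin (suc n)) (s<b : toℕ s ℕ.< toℕ b)
             (s≤orbit : All (λ t → toℕ s ≤ toℕ t) (orbit σ s)) where
      private
        rest≥s : All (λ x → toℕ (inject₁ s) ≤ toℕ (proj₁ x)) (drop 1 (cycleWord σ s))
        rest≥s = All.map⁺ (All.map (ℕ.≤-trans (ℕ.≤-reflexive (toℕ-inject₁ s))) (All.tail s≤orbit))

      run-cycleWord : run b (cycleWord σ s) ≡ inject₁ s
      run-cycleWord rewrite dec-true (toℕ s ℕ.<? toℕ b) s<b = run-above (inject₁ s) _ rest≥s

      pathWeight-cycleWord : pathWeight b (cycleWord σ s) ≈ - 1#
      pathWeight-cycleWord rewrite dec-true (toℕ s ℕ.<? toℕ b) s<b =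
        trans (*-congˡ (pathWeight-above (inject₁ s) _ rest≥s)) (*-identityʳ (- 1#))

    pathWeight-cycleWords : ∀ σ b L → AllPairs ℕ._>_ (toℕ b ∷ map toℕ L) →
      pathWeight b (concatMap (cycleWord σ) (filterB (isCycleMin σ) L)) ≈ sign (length (filterB (isCycleMin σ) L))
    pathWeight-cycleWords σ b []      _                                = ≈-refl
    pathWeight-cycleWords σ b (s ∷ L) ((s<b ∷ L<b) ∷ (L<s ∷ L-descending)) with isCycleMin σ s in isMin
    ... | false = pathWeight-cycleWords σ b L (L<b ∷ L-descending)
    ... | true  = begin
      pathWeight b (cycleWord σ s ++ words)
        ≈⟨ pathWeight-++ b (cycleWord σ s) words ⟩
      pathWeight b (cycleWord σ s) * pathWeight (run b (cycleWord σ s)) words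
        ≈⟨ *-cong (pathWeight-cycleWord σ s b s<b s≤orbit)
                  (reflexive (cong (λ r → pathWeight r words) (run-cycleWord σ s b s<b s≤orbit))) ⟩
      - 1# * pathWeight (inject₁ s) words
        ≈⟨ *-congˡ (pathWeight-cycleWords σ (inject₁ s) L descending) ⟩
      - 1# * sign (length mins)
        ≈⟨ sym (sign-suc (length mins)) ⟩
      sign (suc (length mins)) ∎
      where
      mins = filterB (isCycleMin σ) L
      words = concatMap (cycleWord σ) mins
      s≤orbit : All (λ t → toℕ s ≤ toℕ t) (orbit σ s)
      s≤orbit = All.map (λ {t} s≤ᵇt → ℕ.≤ᵇ⇒≤ (toℕ s) (toℕ t) (Equivalence.from T-≡ s≤ᵇt)) (allB⇒All (orbit σ s) isMin)
      descending : AllPairs ℕ._>_ (toℕ (inject₁ s) ∷ map toℕ L)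
      descending = ≡.subst (λ z → AllPairs ℕ._>_ (z ∷ map toℕ L)) (≡.sym (toℕ-inject₁ s)) (L<s ∷ L-descending)

    series-wordOf : (v : Vec (Fin n) n) → series (wordOf v) ≈ sgn v
    series-wordOf v = begin
      sign n * pathWeight (fromℕ n) (wordOf v)
        ≈⟨ *-congˡ (pathWeight-cycleWords σ (fromℕ n) (reverse (allFin n)) descending) ⟩
      sign n * sign cycles
        ≡⟨ cong (λ k → sign k * sign cycles) (≡.sym (ℕ.m∸n+n≡m cycles≤n)) ⟩
      sign (n ∸ cycles ℕ.+ cycles) * sign cycles
        ≈⟨ *-congʳ (sign-+ (n ∸ cycles) cycles) ⟩
      sign (n ∸ cycles) * sign cycles * sign cycles
        ≈⟨ *-assoc _ _ _ ⟩
      sign (n ∸ cycles) * (sign cycles * sign cycles)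
        ≈⟨ *-congˡ (sign*sign≈1 cycles) ⟩
      sign (n ∸ cycles) * 1#
        ≈⟨ *-identityʳ _ ⟩
      sgn v ∎
      where
      σ = lookup v
      cycles = length (cycleMins σ)
      cycles≤n : cycles ≤ n
      cycles≤n = ℕ.≤-trans (length-filterB (isCycleMin σ) (reverse (allFin n)))
        (ℕ.≤-reflexive (≡.trans (length-reverse (allFin n)) (length-tabulate (λ i → i))))
      descending : AllPairs ℕ._>_ (toℕ (fromℕ n) ∷ map toℕ (reverse (allFin n)))
      descending = ≡.subst (λ z → AllPairs ℕ._>_ (z ∷ map toℕ (reverse (allFin n))))
        (≡.sym (toℕ-fromℕ n)) (reverse-allFin-descending n)

    series*Mperm≈Mdet : ∀ w → series w * Mperm n w ≈ Mdet n w
    series*Mperm≈Mdet w = scale-coefficient wordOf w (series w) (λ _ → 1#) sgn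
      (λ { v refl → trans (*-identityʳ _) (series-wordOf v) }) (Sn n)

    series*Mdet≈Mperm : ∀ w → series w * Mdet n w ≈ Mperm n w
    series*Mdet≈Mperm w = scale-coefficient wordOf w (series w) sgn (λ _ → 1#)
      (λ { v refl → trans (*-congʳ (series-wordOf v)) (sign*sign≈1 (n ∸ length (cycleMins (lookup v)))) }) (Sn n)

theorem7p2 : ∀ {c ℓ : Level} (F : Field c ℓ) →
    Poly.PolySizeComputable F (Poly.Mdet F) ⇔ Poly.PolySizeComputable F (Poly.Mperm F)
theorem7p2 F = mk⇔
  (polySize-≋ F (λ _ → series*Mdet≈Mperm F) ∘ hadamard-polySize F (mooreAutomaton F))
  (polySize-≋ F (λ _ → series*Mperm≈Mdet F) ∘ hadamard-polySize F (mooreAutomaton F))
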